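{- Let $\mathcal X=(\Omega,S)$ be a coherent configuration, $\mu,\alpha,\beta\in\Omega$, and put $x=r(\mu,\alpha)$, $r=r(\alpha,\beta)$, $y=r(\mu,\beta)$. Suppose $c_{xr}^y=1$. Then $n_x\le n_y$. Moreover, if $n_x$ equals the maximal valency of $\mathcal X$, then $c_{yr^*}^x=1$.
   Context: A coherent configuration is a pair $(\Omega,S)$, $\Omega$ finite, $S$ a partition of $\Omega\times\Omega$ with the diagonal a union of elements of $S$, $S$ closed under $r\mapsto r^*=\{(\beta,\alpha):(\alpha,\beta)\in r\}$, and with $c_{rs}^t=|\{\gamma:(\alpha,\gamma)\in r,(\gamma,\beta)\in s\}|$ independent of $(\alpha,\beta)\in t$. $r(\alpha,\beta)$ denotes the element of $S$ containing $(\alpha,\beta)$. The valency $n_s$ of $s\in S$ is $|\{\beta:(\alpha,\beta)\in s\}|$ for any $\alpha$ for which this is nonempty; the maximal valency is $\max_s n_s$. -}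

module Defs where

open import Data.Nat using (ℕ; zero; suc; _+_; _⊔_)
open import Data.Fin using (Fin; zero; suc)
open import Data.Fin.Properties using (_≟_)
open import Data.Product using (Σ; ∃; _×_; _,_)
open import Relation.Nullary using (Dec; yes; no)
open import Relation.Nullary.Decidable using (_×-dec_)
open import Relation.Binary.PropositionalEquality using (_≡_)
open import Function.Bundles using (_⇔_)

count : ∀ {n} {P : Fin n → Set} → ((i : Fin n) → Dec (P i)) → ℕ
count {zero}  d = 0
count {suc n} d with d zero
... | yes _ = suc (count (λ i → d (suc i)))
... | no  _ = count (λ i → d (suc i))

maxFin : ∀ {n} → (Fin n → ℕ) → ℕ
maxFin {zero}  f = 0
maxFin {suc n} f = f zero ⊔ maxFin (λ i → f (suc i))

-- Ω = Fin n; the partition S is given by a labelling rel : Ω → Ω → Fin m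
-- of pairs by basis relations: rel a b is r(a,b), and the element of S with
-- label s is {(a,b) | rel a b ≡ s}.

inter : ∀ {n m} → (Fin n → Fin n → Fin m) → Fin m → Fin m → Fin n → Fin n → ℕ
inter {n} rel s t a b = count {n} (λ g → (rel a g ≟ s) ×-dec (rel g b ≟ t))

-- |{b : (a,b) ∈ s}|  (this is n_s whenever the row of a in s is nonempty)
rowCount : ∀ {n m} → (Fin n → Fin n → Fin m) → Fin m → Fin n → ℕ
rowCount {n} rel s a = count {n} (λ b → rel a b ≟ s)

-- maximal valency: max over all (a,b) of the valency of r(a,b),
-- computed at the point a (whose row in r(a,b) is nonempty)
maxValency : ∀ {n m} → (Fin n → Fin n → Fin m) → ℕ
maxValency rel = maxFin (λ a → maxFin (λ b → rowCount rel (rel a b) a))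

record CoherentConfiguration (n m : ℕ) : Set where
  field
    rel : Fin n → Fin n → Fin m
    -- every label denotes a nonempty class (so labels = elements of S)
    surj : (s : Fin m) → ∃ λ a → ∃ λ b → rel a b ≡ s
    -- the diagonal is a union of classes
    diag : ∀ a b c → rel b c ≡ rel a a → b ≡ c
    transp : (s : Fin m) → Σ (Fin m) λ t → ∀ a b → (rel a b ≡ s) ⇔ (rel b a ≡ t)
    coherent : ∀ s t a b a' b' → rel a b ≡ rel a' b' → inter rel s t a b ≡ inter rel s t a' b'

-- Count the triangles (γ, δ) with r(μ,γ) = x, r(μ,δ) = y, r(γ,δ) = r in two
-- ways. Grouping by δ gives n_y c_{xr}^y, grouping by γ gives n_x c_{yr*}^x.
-- With c_{xr}^y = 1 this says n_y = n_x c_{yr*}^x, and c_{yr*}^x ≥ 1 since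
-- β is a witness; if n_x is the maximal valency then n_x c_{yr*}^x = n_y ≤ n_x
-- forces c_{yr*}^x = 1.
module Submission where

open import Defs
open import Data.Nat using (ℕ; zero; suc; _+_; _*_; _≤_; _<_; z<s; >-nonZero)
open import Data.Nat.Properties
  using (+-*-semiring; *-commutativeSemigroup; +-identityʳ; *-identityʳ;
         ≤-trans; ≤-antisym; m≤m⊔n; m≤n⊔m; m≤m*n; *-cancelˡ-≤; module ≤-Reasoning)
open import Data.Fin using (Fin; zero; suc)
open import Data.Fin.Properties using (_≟_)
open import Data.Product using (_×_; _,_; proj₁; proj₂)
open import Relation.Nullary using (Dec; yes; no)
open import Relation.Nullary.Decidable using (_×-dec_)
open import Relation.Binary.PropositionalEquality
  using (_≡_; refl; sym; trans; cong; cong₂; subst; module ≡-Reasoning)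
open import Function.Bundles using (_⇔_; Equivalence; mk⇔)
open import Data.Empty using (⊥-elim)
open import Algebra.Properties.Semiring.Sum +-*-semiring
  using (sum-syntax; sum-cong-≗; ∑-comm; *-distribˡ-sum)
open import Algebra.Properties.CommutativeSemigroup *-commutativeSemigroup
  using (x∙yz≈y∙xz)

𝟙 : ∀ {P : Set} → Dec P → ℕ
𝟙 (yes _) = 1
𝟙 (no _)  = 0

𝟙-×-dec : ∀ {A B : Set} (a : Dec A) (b : Dec B) → 𝟙 (a ×-dec b) ≡ 𝟙 a * 𝟙 b
𝟙-×-dec (yes _) (yes _) = refl
𝟙-×-dec (yes _) (no _)  = refl
𝟙-×-dec (no _)  _       = refl

𝟙-cong : ∀ {A B : Set} → A ⇔ B → (a : Dec A) (b : Dec B) → 𝟙 a ≡ 𝟙 b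
𝟙-cong A⇔B (yes _) (yes _) = refl
𝟙-cong A⇔B (yes a) (no ¬b) = ⊥-elim (¬b (Equivalence.to A⇔B a))
𝟙-cong A⇔B (no ¬a) (yes b) = ⊥-elim (¬a (Equivalence.from A⇔B b))
𝟙-cong A⇔B (no _)  (no _)  = refl

count≡∑𝟙 : ∀ {n} {P : Fin n → Set} (d : ∀ i → Dec (P i)) → count d ≡ ∑[ i < n ] 𝟙 (d i)
count≡∑𝟙 {zero}  d = refl
count≡∑𝟙 {suc n} d with d zero
... | yes _ = cong suc (count≡∑𝟙 (λ i → d (suc i)))
... | no _  = count≡∑𝟙 (λ i → d (suc i))

∑𝟙*-constant : ∀ {n} {P : Fin n → Set} (d : ∀ i → Dec (P i)) (f : Fin n → ℕ) {c : ℕ} →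
               (∀ i → P i → f i ≡ c) → ∑[ i < n ] (𝟙 (d i) * f i) ≡ count d * c
∑𝟙*-constant {zero}  d f f≡c = refl
∑𝟙*-constant {suc n} d f f≡c with d zero
... | yes p = cong₂ _+_ (trans (+-identityʳ (f zero)) (f≡c zero p))
                        (∑𝟙*-constant (λ i → d (suc i)) (λ i → f (suc i)) (λ i → f≡c (suc i)))
... | no _  = ∑𝟙*-constant (λ i → d (suc i)) (λ i → f (suc i)) (λ i → f≡c (suc i))

count-positive : ∀ {n} {P : Fin n → Set} (d : ∀ i → Dec (P i)) (i : Fin n) → P i → 0 < count d
count-positive {suc n} d i p with d zero
count-positive {suc n} d i       p | yes _ = z<s
count-positive {suc n} d zero    p | no ¬p = ⊥-elim (¬p p)
count-positive {suc n} d (suc i) p | no _  = count-positive (λ j → d (suc j)) i p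

≤maxFin : ∀ {n} (f : Fin n → ℕ) (i : Fin n) → f i ≤ maxFin f
≤maxFin f zero    = m≤m⊔n _ _
≤maxFin f (suc i) = ≤-trans (≤maxFin (λ j → f (suc j)) i) (m≤n⊔m _ _)

module _ {n m} (X : CoherentConfiguration n m) where
  open CoherentConfiguration X

  valency≤maxValency : ∀ a b → rowCount rel (rel a b) a ≤ maxValency rel
  valency≤maxValency a b =
    ≤-trans (≤maxFin (λ b → rowCount rel (rel a b) a) b)
            (≤maxFin (λ a → maxFin (λ b → rowCount rel (rel a b) a)) a)

  transpose-label : ∀ α β g d → (rel g d ≡ rel α β) ⇔ (rel d g ≡ rel β α)
  transpose-label α β g d = mk⇔
    (λ e → trans (Equivalence.to (tr g d) e) (sym r*≡t))
    (λ e → Equivalence.from (tr g d) (trans e r*≡t))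
    where
    t  = proj₁ (transp (rel α β))
    tr = proj₂ (transp (rel α β))
    r*≡t : rel β α ≡ t
    r*≡t = Equivalence.to (tr α β) refl

  inter≡∑ : ∀ s t a b → inter rel s t a b ≡ ∑[ γ < n ] (𝟙 (rel a γ ≟ s) * 𝟙 (rel γ b ≟ t))
  inter≡∑ s t a b = trans (count≡∑𝟙 (λ γ → (rel a γ ≟ s) ×-dec (rel γ b ≟ t)))
                          (sum-cong-≗ (λ γ → 𝟙-×-dec (rel a γ ≟ s) (rel γ b ≟ t)))

  ∑row-inter≡valency*inter : ∀ s t μ β →
    ∑[ δ < n ] (𝟙 (rel μ δ ≟ rel μ β) * inter rel s t μ δ)
      ≡ rowCount rel (rel μ β) μ * inter rel s t μ β
  ∑row-inter≡valency*inter s t μ β =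
    ∑𝟙*-constant _ (inter rel s t μ) (λ δ e → coherent s t μ δ μ β e)

  ∑row-inter≡triangles : ∀ s t u μ →
    ∑[ δ < n ] (𝟙 (rel μ δ ≟ u) * inter rel s t μ δ)
      ≡ ∑[ δ < n ] ∑[ γ < n ] (𝟙 (rel μ δ ≟ u) * (𝟙 (rel μ γ ≟ s) * 𝟙 (rel γ δ ≟ t)))
  ∑row-inter≡triangles s t u μ = sum-cong-≗ λ δ →
    trans (cong (𝟙 (rel μ δ ≟ u) *_) (inter≡∑ s t μ δ))
          (*-distribˡ-sum (𝟙 (rel μ δ ≟ u)) (λ γ → 𝟙 (rel μ γ ≟ s) * 𝟙 (rel γ δ ≟ t)))

  valency*inter≡valency*inter-transpose : ∀ μ α β γ δ →
    rowCount rel (rel μ β) μ * inter rel (rel μ α) (rel γ δ) μ β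
      ≡ rowCount rel (rel μ α) μ * inter rel (rel μ β) (rel δ γ) μ α
  valency*inter≡valency*inter-transpose μ α β γ δ = begin
      rowCount rel y μ * inter rel x r μ β
    ≡⟨ sym (∑row-inter≡valency*inter x r μ β) ⟩
      ∑[ b < n ] (𝟙 (rel μ b ≟ y) * inter rel x r μ b)
    ≡⟨ ∑row-inter≡triangles x r y μ ⟩
      ∑[ b < n ] ∑[ a < n ] (𝟙 (rel μ b ≟ y) * (𝟙 (rel μ a ≟ x) * 𝟙 (rel a b ≟ r)))
    ≡⟨ ∑-comm (λ b a → 𝟙 (rel μ b ≟ y) * (𝟙 (rel μ a ≟ x) * 𝟙 (rel a b ≟ r))) ⟩
      ∑[ a < n ] ∑[ b < n ] (𝟙 (rel μ b ≟ y) * (𝟙 (rel μ a ≟ x) * 𝟙 (rel a b ≟ r)))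
    ≡⟨ sum-cong-≗ (λ a → sum-cong-≗ (λ b → swap-corners a b)) ⟩
      ∑[ a < n ] ∑[ b < n ] (𝟙 (rel μ a ≟ x) * (𝟙 (rel μ b ≟ y) * 𝟙 (rel b a ≟ r*)))
    ≡⟨ sym (∑row-inter≡triangles y r* x μ) ⟩
      ∑[ a < n ] (𝟙 (rel μ a ≟ x) * inter rel y r* μ a)
    ≡⟨ ∑row-inter≡valency*inter y r* μ α ⟩
      rowCount rel x μ * inter rel y r* μ α
    ∎
    where
    open ≡-Reasoning
    x = rel μ α
    y = rel μ β
    r = rel γ δ
    r* = rel δ γ
    swap-corners : ∀ a b → 𝟙 (rel μ b ≟ y) * (𝟙 (rel μ a ≟ x) * 𝟙 (rel a b ≟ r))
                         ≡ 𝟙 (rel μ a ≟ x) * (𝟙 (rel μ b ≟ y) * 𝟙 (rel b a ≟ r*))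
    swap-corners a b = trans (x∙yz≈y∙xz (𝟙 (rel μ b ≟ y)) (𝟙 (rel μ a ≟ x)) (𝟙 (rel a b ≟ r)))
      (cong (λ k → 𝟙 (rel μ a ≟ x) * (𝟙 (rel μ b ≟ y) * k)) (𝟙-cong (transpose-label γ δ a b) _ _))

lemma2p8 : ∀ {n m} (X : CoherentConfiguration n m) (μ α β : Fin n) →
    let rel = CoherentConfiguration.rel X
        x = rel μ α
        r = rel α β
        y = rel μ β
    in inter rel x r μ β ≡ 1 →
       (rowCount rel x μ ≤ rowCount rel y μ)
       × (rowCount rel x μ ≡ maxValency rel → inter rel y (rel β α) μ α ≡ 1)
lemma2p8 X μ α β c≡1 = nx≤ny , λ nx≡max → ≤-antisym (c*≤1 nx≡max) c*>0
  where
  open CoherentConfiguration X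
  nx = rowCount rel (rel μ α) μ
  ny = rowCount rel (rel μ β) μ
  c* = inter rel (rel μ β) (rel β α) μ α
  nx>0 : 0 < nx
  nx>0 = count-positive _ α refl
  c*>0 : 0 < c*
  c*>0 = count-positive _ β (refl , refl)
  ny≡nx*c* : ny ≡ nx * c*
  ny≡nx*c* = begin
    ny                                     ≡⟨ sym (*-identityʳ ny) ⟩
    ny * 1                                 ≡⟨ cong (ny *_) (sym c≡1) ⟩
    ny * inter rel (rel μ α) (rel α β) μ β ≡⟨ valency*inter≡valency*inter-transpose X μ α β α β ⟩
    nx * c*                                ∎
    where open ≡-Reasoning
  nx≤ny : nx ≤ ny
  nx≤ny = subst (nx ≤_) (sym ny≡nx*c*) (m≤m*n nx c* {{>-nonZero c*>0}})
  c*≤1 : nx ≡ maxValency rel → c* ≤ 1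
  c*≤1 nx≡max = *-cancelˡ-≤ nx {{>-nonZero nx>0}} (begin
    nx * c*        ≡⟨ sym ny≡nx*c* ⟩
    ny             ≤⟨ valency≤maxValency X μ β ⟩
    maxValency rel ≡⟨ sym nx≡max ⟩
    nx             ≡⟨ sym (*-identityʳ nx) ⟩
    nx * 1         ∎)
    where open ≤-Reasoning
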